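{- Let $m\geq 3$ and let $G=S(2^2,1^{m-2})$ be the starlike tree of order $m+3$, i.e. the tree on vertices $o,x_1,\dots,x_m,y,z$ with edges $ox_1,\dots,ox_m$, $x_1y$ and $x_2z$. Let $H$ be a distance-balanced graph which contains $G$ as a spanning subgraph. Then $\mathrm{diam}(H)\leq 2$, and hence $H$ is $r$-regular for some integer $r\geq m$.
   Context: All graphs are finite and simple. For vertices $u,v$ of a graph $H$, $d_H(u,v)$ is the length of a shortest $u$–$v$ path, and $\mathrm{diam}(H)=\max_{u,v} d_H(u,v)$. For an edge $xy$ of $H$, $W^H_{xy}=\{u\in V(H): d_H(u,x)<d_H(u,y)\}$. A graph $H$ is distance-balanced if $|W^H_{xy}|=|W^H_{yx}|$ for every edge $xy$ of $H$. A starlike tree is a tree with exactly one vertex of degree greater than two; $S(n_1^{\alpha_1},\dots,n_k^{\alpha_k})$ denotes the starlike tree in which deleting the central vertex leaves $\alpha_i$ paths with $n_i$ vertices for each $i$. -}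

module Defs where

open import Data.Nat using (ℕ; zero; suc; _+_; _≤_; _<_; _<?_)
open import Data.Nat.Properties using ()
open import Data.Fin using (Fin; toℕ)
open import Data.Bool using (Bool; true; false)
import Data.Bool
import Data.Fin as Fin
open import Data.List using (List; length; filter)
open import Data.List using () renaming (allFin to allFinL)
open import Data.Product using (_×_; ∃-syntax)
open import Relation.Binary.PropositionalEquality using (_≡_)

record SimpleGraph (n : ℕ) : Set where
  field
    adj       : Fin n → Fin n → Bool
    symmetric : ∀ u v → adj u v ≡ adj v u
    loopless  : ∀ u → adj u u ≡ false

open SimpleGraph public

Edge : ∀ {n} → SimpleGraph n → Fin n → Fin n → Set
Edge H u v = adj H u v ≡ true

data Walk {n : ℕ} (H : SimpleGraph n) : Fin n → Fin n → ℕ → Set where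
  nil  : ∀ {u} → Walk H u u zero
  cons : ∀ {u w v k} → Edge H u w → Walk H w v k → Walk H u v (suc k)

IsDistance : ∀ {n} → SimpleGraph n → (Fin n → Fin n → ℕ) → Set
IsDistance H d =
  ∀ u v → Walk H u v (d u v) × (∀ k → Walk H u v k → d u v ≤ k)

W : ∀ {n} → (Fin n → Fin n → ℕ) → Fin n → Fin n → List (Fin n)
W d x y = filter (λ u → d u x <? d u y) (allFinL _)

DistanceBalanced : ∀ {n} → SimpleGraph n → (Fin n → Fin n → ℕ) → Set
DistanceBalanced H d =
  ∀ x y → Edge H x y → length (W d x y) ≡ length (W d y x)

DiamAtMost2 : ∀ {n} → (Fin n → Fin n → ℕ) → Set
DiamAtMost2 d = ∀ u v → d u v ≤ 2

degree : ∀ {n} → SimpleGraph n → Fin n → ℕ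
degree H v = length (filter (λ u → adj H v u Data.Bool.≟ true) (allFinL _))

Regular : ∀ {n} → SimpleGraph n → ℕ → Set
Regular H r = ∀ v → degree H v ≡ r

-- Vertex labelling of G = S(2^2, 1^(m-2)) on Fin (3 + m):
--   o = 0, y = 1, z = 2, x_{i+1} = 3 + i  for i : Fin m.
module Labels (m : ℕ) where
  o y z : Fin (3 + m)
  o = Fin.zero
  y = Fin.suc Fin.zero
  z = Fin.suc (Fin.suc Fin.zero)
  x : Fin m → Fin (3 + m)
  x i = Fin.suc (Fin.suc (Fin.suc i))

ContainsG : (m : ℕ) → SimpleGraph (3 + m) → Set
ContainsG m H =
  (∀ i → Edge H o (x i)) ×
  (∀ i → toℕ i ≡ 0 → Edge H (x i) y) ×
  (∀ i → toℕ i ≡ 1 → Edge H (x i) z)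
  where open Labels m

-- In a distance-balanced graph, |d(u,x) − d(u,y)| ≤ 1 along an edge xy turns
-- |W_xy| = |W_yx| into D(x) = D(y) for the transmission D(x) = Σ_u d(u,x);
-- H being connected, D is constant. With n = m + 3 vertices, o is adjacent to
-- every x_i and y, z lie at distance 2 from o, so D(o) ≤ n + 1. Summing the
-- triangle inequality over all vertices gives n·d(v,w) ≤ D(v) + D(w) ≤ 2n + 2
-- < 3n, hence diam(H) ≤ 2. Once the diameter is at most 2, every vertex x has
-- D(x) + deg(x) = 2(n − 1), so constant transmission forces H to be regular,
-- of degree deg(o) ≥ m.
module Submission where

open import Defs
open import Data.Nat using (ℕ; _≤_; _+_)
open import Data.Fin using (Fin)
open import Data.Product using (_×_; ∃-syntax)

open import Data.Bool using (Bool; true; false)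
import Data.Bool as Bool
open import Data.Fin using (zero; suc; punchIn)
open import Data.Fin.Properties using (punchInᵢ≢i)
open import Data.List using (length; filter; tabulate)
open import Data.Nat using (zero; suc; _*_; _<_; _<?_; _≤?_; z≤n; s≤s)
open import Data.Nat.Properties
  using ( +-0-commutativeMonoid; +-comm; +-identityʳ; +-cancelˡ-≡; +-cancelʳ-≡
        ; *-identityʳ; *-monoʳ-≤; +-mono-≤; m≤n+m; m≤m+n; n≤0⇒n≡0; n≢0⇒n>0
        ; ≤-trans; ≤-reflexive; ≤-antisym; ≤-<-trans; <-asym; <⇒≱; ≰⇒>; ≮⇒≥
        ; module ≤-Reasoning )
open import Data.Nat.Tactic.RingSolver using (solve-∀)
open import Data.Product using (_,_; proj₁; proj₂)
open import Function using (id; _∘_)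
open import Relation.Nullary using (Dec; does; yes; no; contradiction)
open import Relation.Unary using (Decidable)
open import Relation.Binary.PropositionalEquality
  using (_≡_; _≢_; refl; sym; trans; cong; cong₂; subst; module ≡-Reasoning)

open import Algebra.Properties.CommutativeMonoid.Sum +-0-commutativeMonoid
  using (sum; sum-syntax; sum-cong-≗; sum-remove; ∑-distrib-+)

𝟙 : Bool → ℕ
𝟙 true  = 1
𝟙 false = 0

sum-const : ∀ n c → ∑[ i < n ] c ≡ n * c
sum-const zero    c = refl
sum-const (suc n) c = cong (c +_) (sum-const n c)

sum-mono-≤ : ∀ {n} {f g : Fin n → ℕ} → (∀ i → f i ≤ g i) → sum f ≤ sum g
sum-mono-≤ {zero}  f≤g = z≤n
sum-mono-≤ {suc n} f≤g = +-mono-≤ (f≤g zero) (sum-mono-≤ (f≤g ∘ suc))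

sum-tail-≤ : ∀ {n} (f : Fin (suc n) → ℕ) → sum (f ∘ suc) ≤ sum f
sum-tail-≤ f = m≤n+m _ (f zero)

length-filter-tabulate : ∀ {A : Set} {P : A → Set} (P? : Decidable P) {n} (f : Fin n → A) →
  length (filter P? (tabulate f)) ≡ ∑[ i < n ] 𝟙 (does (P? (f i)))
length-filter-tabulate P? {zero}  f = refl
length-filter-tabulate P? {suc n} f with does (P? (f zero))
... | true  = cong suc (length-filter-tabulate P? (f ∘ suc))
... | false = length-filter-tabulate P? (f ∘ suc)

+𝟙<-balanced : ∀ {a b} → a ≤ suc b → b ≤ suc a → (a<b? : Dec (a < b)) (b<a? : Dec (b < a)) →
  a + 𝟙 (does a<b?) ≡ b + 𝟙 (does b<a?)
+𝟙<-balanced         _     _     (yes a<b) (yes b<a) = contradiction b<a (<-asym a<b)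
+𝟙<-balanced {a} {b} _     b≤1+a (yes a<b) (no  _)   = trans (+-comm a 1) (trans (≤-antisym a<b b≤1+a) (sym (+-identityʳ b)))
+𝟙<-balanced {a} {b} a≤1+b _     (no  _)   (yes b<a) = trans (+-identityʳ a) (trans (≤-antisym a≤1+b b<a) (+-comm 1 b))
+𝟙<-balanced         _     _     (no  a≮b) (no  b≮a) = cong (_+ 0) (≤-antisym (≮⇒≥ b≮a) (≮⇒≥ a≮b))

module Walks {n} (H : SimpleGraph n) where

  edge-sym : ∀ {u v} → Edge H u v → Edge H v u
  edge-sym {u} {v} e = trans (symmetric H v u) e

  edge⇒≢ : ∀ {u v} → Edge H u v → u ≢ v
  edge⇒≢ {u} e refl with trans (sym e) (loopless H u)
  ... | ()

  _∷ʳ_ : ∀ {u v w k} → Walk H u v k → Edge H v w → Walk H u w (suc k)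
  nil      ∷ʳ e′ = cons e′ nil
  cons e p ∷ʳ e′ = cons e (p ∷ʳ e′)

  _++_ : ∀ {u v w k l} → Walk H u v k → Walk H v w l → Walk H u w (k + l)
  nil      ++ q = q
  cons e p ++ q = cons e (p ++ q)

  reverse : ∀ {u v k} → Walk H u v k → Walk H v u k
  reverse nil        = nil
  reverse (cons e p) = reverse p ∷ʳ edge-sym e

  walk-length-0 : ∀ {u v} → Walk H u v 0 → u ≡ v
  walk-length-0 nil = refl

  walk-length-1 : ∀ {u v} → Walk H u v 1 → Edge H u v
  walk-length-1 (cons e nil) = e

module Distance {n} (H : SimpleGraph n) (d : Fin n → Fin n → ℕ) (isDistance : IsDistance H d) where
  open Walks H public

  shortest : ∀ u v → Walk H u v (d u v)
  shortest u v = proj₁ (isDistance u v)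

  d-minimal : ∀ {u v k} → Walk H u v k → d u v ≤ k
  d-minimal {u} {v} {k} = proj₂ (isDistance u v) k

  d-refl : ∀ u → d u u ≡ 0
  d-refl u = n≤0⇒n≡0 (d-minimal nil)

  d≡0⇒≡ : ∀ {u v} → d u v ≡ 0 → u ≡ v
  d≡0⇒≡ {u} {v} eq = walk-length-0 (subst (Walk H u v) eq (shortest u v))

  d≡1⇒edge : ∀ {u v} → d u v ≡ 1 → Edge H u v
  d≡1⇒edge {u} {v} eq = walk-length-1 (subst (Walk H u v) eq (shortest u v))

  d-sym : ∀ u v → d u v ≡ d v u
  d-sym u v = ≤-antisym (d-minimal (reverse (shortest v u))) (d-minimal (reverse (shortest u v)))

  d-triangle : ∀ u v w → d u w ≤ d u v + d v w
  d-triangle u v w = d-minimal (shortest u v ++ shortest v w)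

  d-edge : ∀ {u v} → Edge H u v → d u v ≡ 1
  d-edge e = ≤-antisym (d-minimal (cons e nil)) (n≢0⇒n>0 (edge⇒≢ e ∘ d≡0⇒≡))

  d-step : ∀ {x y} → Edge H x y → ∀ u → d u y ≤ suc (d u x)
  d-step e u = d-minimal (shortest u _ ∷ʳ e)

  constant-on-edges : ∀ {A : Set} (f : Fin n → A) →
    (∀ {x y} → Edge H x y → f x ≡ f y) → ∀ u v → f u ≡ f v
  constant-on-edges f f-edge u v = along (shortest u v)
    where
    along : ∀ {u v k} → Walk H u v k → f u ≡ f v
    along nil        = refl
    along (cons e p) = trans (f-edge e) (along p)

  transmission : Fin n → ℕ
  transmission x = ∑[ u < n ] d u x

  length-W : ∀ x y → length (W d x y) ≡ ∑[ u < n ] 𝟙 (does (d u x <? d u y))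
  length-W x y = length-filter-tabulate (λ u → d u x <? d u y) id

  transmission-edge : DistanceBalanced H d → ∀ {x y} → Edge H x y → transmission x ≡ transmission y
  transmission-edge balanced {x} {y} e = +-cancelʳ-≡ (length (W d x y)) _ _ (begin
    transmission x + length (W d x y)                     ≡⟨ cong (transmission x +_) (length-W x y) ⟩
    transmission x + ∑[ u < n ] 𝟙 (does (d u x <? d u y))  ≡⟨ ∑-distrib-+ (λ u → d u x) (λ u → 𝟙 (does (d u x <? d u y))) ⟨
    ∑[ u < n ] (d u x + 𝟙 (does (d u x <? d u y)))         ≡⟨ sum-cong-≗ (λ u → +𝟙<-balanced (d-step (edge-sym e) u) (d-step e u) (d u x <? d u y) (d u y <? d u x)) ⟩
    ∑[ u < n ] (d u y + 𝟙 (does (d u y <? d u x)))         ≡⟨ ∑-distrib-+ (λ u → d u y) (λ u → 𝟙 (does (d u y <? d u x))) ⟩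
    transmission y + ∑[ u < n ] 𝟙 (does (d u y <? d u x))  ≡⟨ cong (transmission y +_) (length-W y x) ⟨
    transmission y + length (W d y x)                     ≡⟨ cong (transmission y +_) (balanced x y e) ⟨
    transmission y + length (W d x y)                     ∎)
    where open ≡-Reasoning

  transmission-constant : DistanceBalanced H d → ∀ u v → transmission u ≡ transmission v
  transmission-constant balanced = constant-on-edges transmission (transmission-edge balanced)

  *-d≤transmission+transmission : ∀ v w → n * d v w ≤ transmission v + transmission w
  *-d≤transmission+transmission v w = begin
    n * d v w                      ≡⟨ sum-const n (d v w) ⟨
    ∑[ t < n ] d v w               ≤⟨ sum-mono-≤ (λ t → ≤-trans (d-triangle v t w) (≤-reflexive (cong (_+ d t w) (d-sym v t)))) ⟩
    ∑[ t < n ] (d t v + d t w)     ≡⟨ ∑-distrib-+ (λ t → d t v) (λ t → d t w) ⟩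
    transmission v + transmission w ∎
    where open ≤-Reasoning

  diameter≤2 : (∀ v w → transmission v + transmission w < n * 3) → DiamAtMost2 d
  diameter≤2 small v w with d v w ≤? 2
  ... | yes d≤2 = d≤2
  ... | no  d≰2 = contradiction (≤-trans (*-monoʳ-≤ n (≰⇒> d≰2)) (*-d≤transmission+transmission v w))
                                (<⇒≱ (small v w))

module Regularity {n} (H : SimpleGraph (suc n)) (d : Fin (suc n) → Fin (suc n) → ℕ)
                  (isDistance : IsDistance H d) where
  open Distance H d isDistance

  degree-sum : ∀ v → degree H v ≡ ∑[ u < suc n ] 𝟙 (adj H v u)
  degree-sum v = trans (length-filter-tabulate (λ u → adj H v u Bool.≟ true) id)
                       (sum-cong-≗ (λ u → cong 𝟙 (does-≟-true (adj H v u))))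
    where
    does-≟-true : ∀ b → does (b Bool.≟ true) ≡ b
    does-≟-true true  = refl
    does-≟-true false = refl

  d+adjacency≡2 : DiamAtMost2 d → ∀ {u x} → u ≢ x → d u x + 𝟙 (adj H x u) ≡ 2
  d+adjacency≡2 diam {u} {x} u≢x with adj H x u in x~u
  ... | true  = cong (_+ 1) (d-edge (edge-sym x~u))
  ... | false with d u x in du | diam u x
  ...   | 0                 | _ = contradiction (d≡0⇒≡ du) u≢x
  ...   | 1                 | _ = contradiction (trans (sym (edge-sym (d≡1⇒edge du))) x~u) λ ()
  ...   | 2                 | _ = refl
  ...   | suc (suc (suc _)) | s≤s (s≤s ())

  transmission+degree : DiamAtMost2 d → ∀ x → transmission x + degree H x ≡ n * 2
  transmission+degree diam x = begin
    transmission x + degree H x                             ≡⟨ cong (transmission x +_) (degree-sum x) ⟩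
    transmission x + ∑[ u < suc n ] 𝟙 (adj H x u)           ≡⟨ ∑-distrib-+ (λ u → d u x) (λ u → 𝟙 (adj H x u)) ⟨
    ∑[ u < suc n ] (d u x + 𝟙 (adj H x u))                  ≡⟨ sum-remove {i = x} (λ u → d u x + 𝟙 (adj H x u)) ⟩
    (d x x + 𝟙 (adj H x x))
      + ∑[ j < n ] (d (punchIn x j) x + 𝟙 (adj H x (punchIn x j)))
        ≡⟨ cong₂ _+_ (cong₂ _+_ (d-refl x) (cong 𝟙 (loopless H x)))
                     (sum-cong-≗ (λ j → d+adjacency≡2 diam (punchInᵢ≢i x j))) ⟩
    ∑[ j < n ] 2                                            ≡⟨ sum-const n 2 ⟩
    n * 2                                                   ∎
    where open ≡-Reasoning

  degree-constant : DistanceBalanced H d → DiamAtMost2 d → ∀ v w → degree H v ≡ degree H w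
  degree-constant balanced diam v w = +-cancelˡ-≡ (transmission v) _ _ (begin
    transmission v + degree H v ≡⟨ transmission+degree diam v ⟩
    n * 2                       ≡⟨ transmission+degree diam w ⟨
    transmission w + degree H w ≡⟨ cong (_+ degree H w) (transmission-constant balanced w v) ⟩
    transmission v + degree H w ∎)
    where open ≡-Reasoning

two-transmissions<3n : ∀ m → (4 + m) + (4 + m) < (3 + m) * 3
two-transmissions<3n m = subst (suc ((4 + m) + (4 + m)) ≤_) (identity m) (m≤m+n _ m)
  where
  identity : ∀ m → suc ((4 + m) + (4 + m)) + m ≡ (3 + m) * 3
  identity = solve-∀

module SpanningStarlike {k} (H : SimpleGraph (5 + k)) (G : ContainsG (2 + k) H)
                        (d : Fin (5 + k) → Fin (5 + k) → ℕ) (isDistance : IsDistance H d) where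
  open Labels (2 + k)
  open Distance H d isDistance
  open Regularity H d isDistance using (degree-sum)

  o~x : ∀ i → Edge H o (x i)
  o~x = proj₁ G

  d-y-o : d y o ≤ 2
  d-y-o = d-minimal (cons (edge-sym (proj₁ (proj₂ G) zero refl)) (cons (edge-sym (o~x zero)) nil))

  d-z-o : d z o ≤ 2
  d-z-o = d-minimal (cons (edge-sym (proj₂ (proj₂ G) (suc zero) refl)) (cons (edge-sym (o~x (suc zero))) nil))

  transmission-o≤ : transmission o ≤ 4 + (2 + k)
  transmission-o≤ = +-mono-≤ (≤-reflexive (d-refl o)) (+-mono-≤ d-y-o (+-mono-≤ d-z-o (begin
    ∑[ i < 2 + k ] d (x i) o ≤⟨ sum-mono-≤ (λ i → ≤-reflexive (d-edge (edge-sym (o~x i)))) ⟩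
    ∑[ i < 2 + k ] 1         ≡⟨ sum-const (2 + k) 1 ⟩
    (2 + k) * 1              ≡⟨ *-identityʳ (2 + k) ⟩
    2 + k                    ∎)))
    where open ≤-Reasoning

  m≤degree-o : 2 + k ≤ degree H o
  m≤degree-o = begin
    2 + k                              ≡⟨ *-identityʳ (2 + k) ⟨
    (2 + k) * 1                        ≡⟨ sum-const (2 + k) 1 ⟨
    ∑[ i < 2 + k ] 1                   ≡⟨ sum-cong-≗ (λ i → cong 𝟙 (o~x i)) ⟨
    ∑[ i < 2 + k ] 𝟙 (adj H o (x i))   ≤⟨ ≤-trans (sum-tail-≤ (λ u → 𝟙 (adj H o (suc (suc u)))))
                                           (≤-trans (sum-tail-≤ (λ u → 𝟙 (adj H o (suc u))))
                                                    (sum-tail-≤ (λ u → 𝟙 (adj H o u)))) ⟩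
    ∑[ u < 5 + k ] 𝟙 (adj H o u)       ≡⟨ degree-sum o ⟨
    degree H o                         ∎
    where open ≤-Reasoning

theorem4p1 : (m : ℕ) → 3 ≤ m → (H : SimpleGraph (3 + m)) → ContainsG m H →
    (d : Fin (3 + m) → Fin (3 + m) → ℕ) → IsDistance H d → DistanceBalanced H d →
    DiamAtMost2 d × (∃[ r ] (m ≤ r × Regular H r))
theorem4p1 0                 ()
theorem4p1 1                 (s≤s ())
theorem4p1 m@(suc (suc _)) _ H G d isDistance balanced =
  diam , degree H o , m≤degree-o , (λ v → degree-constant balanced diam v o)
  where
  open Labels m
  open Distance H d isDistance
  open Regularity H d isDistance
  open SpanningStarlike H G d isDistance

  transmission≤ : ∀ v → transmission v ≤ 4 + m
  transmission≤ v = ≤-trans (≤-reflexive (transmission-constant balanced v o)) transmission-o≤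

  diam : DiamAtMost2 d
  diam = diameter≤2 λ v w →
    ≤-<-trans (+-mono-≤ (transmission≤ v) (transmission≤ w)) (two-transmissions<3n m)
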